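{- Let $0<k\le n$ be integers, let $x$ be an N-position of Moore's game $\mathrm{NIM}_{n,k}$, and let $K\subseteq\{1,\dots,n\}$ with $|K|=k$. Let $Y_K(x)$ be the set of P-positions $y$ that can be reached from $x$ by a move which decreases only piles with indices in $K$. Then there is a constant $D$ such that $S(y)=D$ for all $y\in Y_K(x)$, where $S(y)=\sum_{i=1}^n y_i$.
   Context: Moore's game $\mathrm{NIM}_{n,k}$: positions are $x\in\mathbb{Z}_+^n$ (pile sizes); a move chooses between $1$ and $k$ nonempty piles and strictly reduces each chosen pile; a player unable to move loses. P-positions are the positions from which the player to move loses under optimal play, N-positions the others. -}

module Defs where

open import Data.Nat using (ℕ; _≤_; _<_; _<?_)
open import Data.Fin using (Fin)
open import Data.Fin.Subset using (Subset; ∣_∣)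
open import Data.Vec using (tabulate; sum)
open import Data.Product using (Σ; _×_)
open import Relation.Nullary.Decidable using (does)

Position : ℕ → Set
Position n = Fin n → ℕ

decreased : ∀ {n} → Position n → Position n → Subset n
decreased x y = tabulate (λ i → does (y i <? x i))

Move : ∀ {n} → ℕ → Position n → Position n → Set
Move k x y = (∀ i → y i ≤ x i) × (1 ≤ ∣ decreased x y ∣) × (∣ decreased x y ∣ ≤ k)

-- N-positions (player to move wins) and P-positions (player to move loses),
-- defined inductively by the game tree (the game is finite, so this is the
-- standard well-founded definition).
mutual
  data NPos {n} (k : ℕ) (x : Position n) : Set where
    win : (y : Position n) → Move k x y → PPos k y → NPos k x

  data PPos {n} (k : ℕ) (x : Position n) : Set where
    lose : ((y : Position n) → Move k x y → NPos k y) → PPos k x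

S : ∀ {n} → Position n → ℕ
S y = sum (tabulate y)

-- Moore's characterisation: y is a P-position of NIM_{n,k} iff in every binary digit the number
-- of piles of y with a 1 there is divisible by k + 1.  No move joins two such balanced positions,
-- since in the most significant digit where they differ the column loses between 1 and k ones.
-- Conversely any position is balanced by changing at most k piles, working from the top digit
-- down: a pile already decreased in a higher digit may take either value in the lower ones.
-- If y is obtained from x by changing only the k piles in K, each column of y consists of the
-- ones of x outside K plus between 0 and k further ones.  Being a multiple of k + 1, it is the
-- unique such multiple in this window of length k + 1, so every column of y, and with them S(y),
-- depends on x and K only.
module Submission where

open import Defs
open import Data.Bool using (Bool; true; false; not; _∧_; _∨_; T)
open import Data.Empty using (⊥-elim)
open import Data.Fin using (Fin; zero; suc)
open import Data.Fin.Subset using (Subset; ∣_∣; _∉_)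
open import Data.Nat using (ℕ; zero; suc; _+_; _*_; _∸_; _^_; _≤_; _<_; z≤n; s≤s; _≤?_; _<ᵇ_; ⌊_/2⌋)
open import Data.Nat.Properties
open import Algebra.Properties.CommutativeSemigroup +-commutativeSemigroup using (interchange)
open import Data.Nat.DivMod using (_%_; _/_; m≡m%n+[m/n]*n; m%n≤m; m%n<n; +-distrib-/-∣ˡ; m*n/n≡m; m<n⇒m/n≡0)
open import Data.Nat.Divisibility using (_∣_; divides; ∣m+n∣m⇒∣n; >⇒∤)
open import Data.Nat.Induction using (<-wellFounded)
open import Data.Nat.Tactic.RingSolver using (solve-∀)
open import Data.Product using (Σ; ∃; _×_; _,_; proj₁; proj₂)
open import Data.Sum using (_⊎_; inj₁; inj₂)
open import Data.Unit using (tt)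
open import Data.Vec using ([]; _∷_; sum; lookup)
open import Data.Vec.Properties using (tabulate-cong; lookup∘tabulate; []=⇒lookup)
open import Function using (_∘_; _⇔_; mk⇔; Equivalence)
open import Induction.WellFounded using (Acc; acc)
open import Relation.Nullary using (¬_; yes; no)
open import Relation.Nullary.Reflects using (ofʸ; ofⁿ)
open import Relation.Binary.PropositionalEquality
  using (_≡_; refl; sym; trans; cong; cong₂; subst; _≗_; module ≡-Reasoning)

S-cong : ∀ {n} {f g : Position n} → f ≗ g → S f ≡ S g
S-cong f≗g = cong sum (tabulate-cong f≗g)

S-0 : ∀ {n} {f : Position n} → (∀ i → f i ≡ 0) → S f ≡ 0
S-0 {zero}  f≡0 = refl
S-0 {suc n} f≡0 = cong₂ _+_ (f≡0 zero) (S-0 (f≡0 ∘ suc))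

S≡0⇒≡0 : ∀ {n} (f : Position n) → S f ≡ 0 → ∀ i → f i ≡ 0
S≡0⇒≡0 f Sf≡0 zero    = m+n≡0⇒m≡0 (f zero) Sf≡0
S≡0⇒≡0 f Sf≡0 (suc i) = S≡0⇒≡0 (f ∘ suc) (m+n≡0⇒n≡0 (f zero) Sf≡0) i

S-distrib-+ : ∀ {n} (f g : Position n) → S (λ i → f i + g i) ≡ S f + S g
S-distrib-+ {zero}  f g = refl
S-distrib-+ {suc n} f g = trans (cong (f zero + g zero +_) (S-distrib-+ (f ∘ suc) (g ∘ suc)))
                                (interchange (f zero) (g zero) (S (f ∘ suc)) (S (g ∘ suc)))

S-distribˡ-* : ∀ {n} c (f : Position n) → S (λ i → c * f i) ≡ c * S f
S-distribˡ-* {zero}  c f = sym (*-zeroʳ c)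
S-distribˡ-* {suc n} c f = trans (cong (c * f zero +_) (S-distribˡ-* c (f ∘ suc)))
                                 (sym (*-distribˡ-+ c (f zero) (S (f ∘ suc))))

S-mono-≤ : ∀ {n} {f g : Position n} → (∀ i → f i ≤ g i) → S f ≤ S g
S-mono-≤ {zero}  f≤g = z≤n
S-mono-≤ {suc n} f≤g = +-mono-≤ (f≤g zero) (S-mono-≤ (f≤g ∘ suc))

S-mono-< : ∀ {n} {f g : Position n} → (∀ i → f i ≤ g i) → ∀ j → f j < g j → S f < S g
S-mono-< f≤g zero    fj<gj = +-mono-<-≤ fj<gj (S-mono-≤ (f≤g ∘ suc))
S-mono-< f≤g (suc j) fj<gj = +-mono-≤-< (f≤g zero) (S-mono-< (f≤g ∘ suc) j fj<gj)

f≤S : ∀ {n} (f : Position n) i → f i ≤ S f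
f≤S f zero    = m≤m+n (f zero) (S (f ∘ suc))
f≤S f (suc i) = ≤-trans (f≤S (f ∘ suc) i) (m≤n+m (S (f ∘ suc)) (f zero))

𝟙 : Bool → ℕ
𝟙 true  = 1
𝟙 false = 0

𝟙-mono : ∀ {a b} → (T a → T b) → 𝟙 a ≤ 𝟙 b
𝟙-mono {false} a⇒b = z≤n
𝟙-mono {true} {true} a⇒b = ≤-refl
𝟙-mono {true} {false} a⇒b = ⊥-elim (a⇒b tt)

count : ∀ {n} → (Fin n → Bool) → ℕ
count p = S (𝟙 ∘ p)

_⊆ᵇ_ : ∀ {n} → (Fin n → Bool) → (Fin n → Bool) → Set
p ⊆ᵇ q = ∀ i → T (p i) → T (q i)

count-mono : ∀ {n} {p q : Fin n → Bool} → p ⊆ᵇ q → count p ≤ count q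
count-mono p⊆q = S-mono-≤ (λ i → 𝟙-mono (p⊆q i))

count-∧-not : ∀ {n} {p q : Fin n → Bool} → q ⊆ᵇ p → count (λ i → p i ∧ not (q i)) + count q ≡ count p
count-∧-not {p = p} {q} q⊆p = trans (sym (S-distrib-+ (𝟙 ∘ λ i → p i ∧ not (q i)) (𝟙 ∘ q)))
                                     (S-cong (λ i → pointwise (p i) (q i) (q⊆p i)))
  where
  pointwise : ∀ a b → (T b → T a) → 𝟙 (a ∧ not b) + 𝟙 b ≡ 𝟙 a
  pointwise true  true  _   = refl
  pointwise true  false _   = refl
  pointwise false true  b⇒a = ⊥-elim (b⇒a tt)
  pointwise false false _   = refl

count-∨-disjoint : ∀ {n} {p q : Fin n → Bool} → (∀ i → T (p i) → ¬ T (q i)) →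
                   count (λ i → p i ∨ q i) ≡ count p + count q
count-∨-disjoint {p = p} {q} disjoint =
  trans (S-cong (λ i → pointwise (p i) (q i) (disjoint i))) (S-distrib-+ (𝟙 ∘ p) (𝟙 ∘ q))
  where
  pointwise : ∀ a b → (T a → ¬ T b) → 𝟙 (a ∨ b) ≡ 𝟙 a + 𝟙 b
  pointwise true  true  a⇒¬b = ⊥-elim (a⇒¬b tt tt)
  pointwise true  false _    = refl
  pointwise false b     _    = sym (+-identityˡ (𝟙 b))

count-pos : ∀ {n} (p : Fin n → Bool) → 1 ≤ count p → ∃ λ i → T (p i)
count-pos {zero}  p ()
count-pos {suc n} p 1≤count with p zero in p₀
... | true  = zero , subst T (sym p₀) tt
... | false with count-pos (p ∘ suc) 1≤count
...   | i , pi = suc i , pi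

subset-of-count : ∀ {n} (p : Fin n → Bool) r → r ≤ count p → Σ (Fin n → Bool) λ q → q ⊆ᵇ p × count q ≡ r
subset-of-count {n} p zero _ = (λ _ → false) , (λ _ ()) , S-0 {n} (λ _ → refl)
subset-of-count {suc n} p (suc r) r<count with p zero in p₀
... | true with subset-of-count (p ∘ suc) r (≤-pred r<count)
...   | q , q⊆p , count≡r = q′ , included , cong suc count≡r
  where
  q′ : Fin (suc n) → Bool
  q′ zero    = true
  q′ (suc i) = q i
  included : q′ ⊆ᵇ p
  included zero    _  = subst T (sym p₀) tt
  included (suc i) qi = q⊆p i qi
subset-of-count {suc n} p (suc r) r<count | false with subset-of-count (p ∘ suc) (suc r) r<count
...   | q , q⊆p , count≡r = q′ , included , count≡r
  where
  q′ : Fin (suc n) → Bool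
  q′ zero    = false
  q′ (suc i) = q i
  included : q′ ⊆ᵇ p
  included (suc i) qi = q⊆p i qi

∣p∣≡count : ∀ {n} (p : Subset n) → ∣ p ∣ ≡ count (lookup p)
∣p∣≡count []          = refl
∣p∣≡count (true ∷ p)  = cong suc (∣p∣≡count p)
∣p∣≡count (false ∷ p) = ∣p∣≡count p

lsb : ℕ → Bool
lsb zero          = false
lsb (suc zero)    = true
lsb (suc (suc m)) = lsb m

consBit : Bool → ℕ → ℕ
consBit b w = 𝟙 b + 2 * w

consBit-suc : ∀ b w → consBit b (suc w) ≡ suc (suc (consBit b w))
consBit-suc b w = lemma (𝟙 b) w
  where
  lemma : ∀ c w → c + 2 * suc w ≡ suc (suc (c + 2 * w))
  lemma = solve-∀

consBit-lsb-⌊/2⌋ : ∀ m → consBit (lsb m) ⌊ m /2⌋ ≡ m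
consBit-lsb-⌊/2⌋ zero          = refl
consBit-lsb-⌊/2⌋ (suc zero)    = refl
consBit-lsb-⌊/2⌋ (suc (suc m)) =
  trans (consBit-suc (lsb m) ⌊ m /2⌋) (cong (λ t → suc (suc t)) (consBit-lsb-⌊/2⌋ m))

lsb-consBit : ∀ b w → lsb (consBit b w) ≡ b
lsb-consBit false zero    = refl
lsb-consBit true  zero    = refl
lsb-consBit b     (suc w) rewrite consBit-suc b w = lsb-consBit b w

⌊consBit/2⌋ : ∀ b w → ⌊ consBit b w /2⌋ ≡ w
⌊consBit/2⌋ false zero    = refl
⌊consBit/2⌋ true  zero    = refl
⌊consBit/2⌋ b     (suc w) rewrite consBit-suc b w = cong suc (⌊consBit/2⌋ b w)

𝟙≤1 : ∀ b → 𝟙 b ≤ 1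
𝟙≤1 true  = ≤-refl
𝟙≤1 false = z≤n

𝟙-< : ∀ {a b} → 𝟙 a < 𝟙 b → a ≡ false × b ≡ true
𝟙-< {false} {true}  _          = refl , refl
𝟙-< {_}     {false} ()
𝟙-< {true}  {true}  (s≤s ())

consBit-<-⌊/2⌋ : ∀ b w m → w < ⌊ m /2⌋ → consBit b w < m
consBit-<-⌊/2⌋ b w m w<h = begin-strict
  𝟙 b + 2 * w              ≤⟨ +-monoˡ-≤ (2 * w) (𝟙≤1 b) ⟩
  1 + 2 * w                <⟨ n<1+n (1 + 2 * w) ⟩
  2 + 2 * w                ≡⟨ sym (*-suc 2 w) ⟩
  2 * suc w                ≤⟨ *-monoʳ-≤ 2 w<h ⟩
  2 * ⌊ m /2⌋              ≤⟨ m≤n+m (2 * ⌊ m /2⌋) (𝟙 (lsb m)) ⟩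
  consBit (lsb m) ⌊ m /2⌋  ≡⟨ consBit-lsb-⌊/2⌋ m ⟩
  m                        ∎
  where open ≤-Reasoning

consBit-≤ : ∀ b w m → w ≤ ⌊ m /2⌋ → (T b → T ((w <ᵇ ⌊ m /2⌋) ∨ lsb m)) → consBit b w ≤ m
consBit-≤ b w m w≤h b⇒ with w <ᵇ ⌊ m /2⌋ | <ᵇ-reflects-< w ⌊ m /2⌋
... | true  | ofʸ w<h = <⇒≤ (consBit-<-⌊/2⌋ b w m w<h)
... | false | ofⁿ _   =
  subst (consBit b w ≤_) (consBit-lsb-⌊/2⌋ m) (+-mono-≤ (𝟙-mono b⇒) (*-monoʳ-≤ 2 w≤h))

consBit-<-lsb : ∀ b {w m} → w ≡ ⌊ m /2⌋ → consBit b w < m → b ≡ false × lsb m ≡ true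
consBit-<-lsb b {m = m} refl cb<m = 𝟙-< (+-cancelʳ-< (2 * ⌊ m /2⌋) (𝟙 b) (𝟙 (lsb m))
  (subst (consBit b ⌊ m /2⌋ <_) (sym (consBit-lsb-⌊/2⌋ m)) cb<m))

consBit-decreased : ∀ b w m → w ≤ ⌊ m /2⌋ → consBit b w < m → T ((w <ᵇ ⌊ m /2⌋) ∨ (lsb m ∧ not b))
consBit-decreased b w m w≤h cb<m with w <ᵇ ⌊ m /2⌋ | <ᵇ-reflects-< w ⌊ m /2⌋
... | true  | _       = tt
... | false | ofⁿ w≮h with consBit-<-lsb b (≤-antisym w≤h (≮⇒≥ w≮h)) cb<m
...   | refl , lsb≡true rewrite lsb≡true = tt

⌊/2⌋-<⇒< : ∀ {a b} → ⌊ a /2⌋ < ⌊ b /2⌋ → a < b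
⌊/2⌋-<⇒< h<h′ = ≰⇒> (λ b≤a → <⇒≱ h<h′ (⌊n/2⌋-mono b≤a))

lsb-step : ∀ a b → a ≤ b → ⌊ a /2⌋ ≡ ⌊ b /2⌋ → 𝟙 (lsb b) ≡ 𝟙 (lsb a) + 𝟙 (a <ᵇ b)
lsb-step a b a≤b h≡h′ with a <ᵇ b | <ᵇ-reflects-< a b
... | false | ofⁿ a≮b rewrite ≤-antisym a≤b (≮⇒≥ a≮b) = sym (+-identityʳ (𝟙 (lsb b)))
... | true  | ofʸ a<b with consBit-<-lsb (lsb a) h≡h′ (subst (_< b) (sym (consBit-lsb-⌊/2⌋ a)) a<b)
...   | la≡false , lb≡true rewrite la≡false | lb≡true = refl

𝟙[<ᵇ]≡0⇔≮ : ∀ a b → 𝟙 (a <ᵇ b) ≡ 0 ⇔ (¬ a < b)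
𝟙[<ᵇ]≡0⇔≮ a b with a <ᵇ b | <ᵇ-reflects-< a b
... | true  | ofʸ a<b = mk⇔ (λ ()) (λ a≮b → ⊥-elim (a≮b a<b))
... | false | ofⁿ a≮b = mk⇔ (λ _ → a≮b) (λ _ → refl)

_≤ᵖ_ : ∀ {n} → Position n → Position n → Set
y ≤ᵖ x = ∀ i → y i ≤ x i

#decreased : ∀ {n} → Position n → Position n → ℕ
#decreased x y = count (λ i → y i <ᵇ x i)

∣decreased∣≡#decreased : ∀ {n} (x y : Position n) → ∣ decreased x y ∣ ≡ #decreased x y
∣decreased∣≡#decreased x y =
  trans (∣p∣≡count (decreased x y)) (S-cong (λ i → cong 𝟙 (lookup∘tabulate (λ i → y i <ᵇ x i) i)))

≗⇒#decreased≡0 : ∀ {n} {x y : Position n} → y ≗ x → #decreased x y ≡ 0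
≗⇒#decreased≡0 {x = x} {y} y≗x =
  S-0 (λ i → Equivalence.from (𝟙[<ᵇ]≡0⇔≮ (y i) (x i)) (λ yi<xi → <-irrefl (y≗x i) yi<xi))

#decreased≡0⇒≗ : ∀ {n} {x y : Position n} → y ≤ᵖ x → #decreased x y ≡ 0 → y ≗ x
#decreased≡0⇒≗ {x = x} {y} y≤x #≡0 i =
  ≤-antisym (y≤x i) (≮⇒≥ (Equivalence.to (𝟙[<ᵇ]≡0⇔≮ (y i) (x i)) (S≡0⇒≡0 _ #≡0 i)))

Move⇒S-< : ∀ {n k} {x y : Position n} → Move k x y → S y < S x
Move⇒S-< {x = x} {y} (y≤x , 1≤∣d∣ , _)
  with count-pos (λ i → y i <ᵇ x i) (subst (1 ≤_) (∣decreased∣≡#decreased x y) 1≤∣d∣)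
... | i , yi<xi = S-mono-< y≤x i (<ᵇ⇒< (y i) (x i) yi<xi)

halve : ∀ {n} → Position n → Position n
halve x i = ⌊ x i /2⌋

column : ∀ {n} → Position n → ℕ
column y = count (lsb ∘ y)

S≡column+2*S[halve] : ∀ {n} (y : Position n) → S y ≡ column y + 2 * S (halve y)
S≡column+2*S[halve] y = begin
  S y                                          ≡⟨ S-cong (λ i → sym (consBit-lsb-⌊/2⌋ (y i))) ⟩
  S (λ i → 𝟙 (lsb (y i)) + 2 * ⌊ y i /2⌋)     ≡⟨ S-distrib-+ (𝟙 ∘ lsb ∘ y) (λ i → 2 * ⌊ y i /2⌋) ⟩
  column y + S (λ i → 2 * ⌊ y i /2⌋)           ≡⟨ cong (column y +_) (S-distribˡ-* 2 (halve y)) ⟩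
  column y + 2 * S (halve y)                   ∎
  where open ≡-Reasoning

Bounded : ∀ {n} → ℕ → Position n → Set
Bounded N x = ∀ i → x i < 2 ^ N

Bounded-≤ᵖ : ∀ {n} N {x y : Position n} → y ≤ᵖ x → Bounded N x → Bounded N y
Bounded-≤ᵖ N y≤x x<2^N i = ≤-<-trans (y≤x i) (x<2^N i)

Bounded-halve : ∀ {n} N {x : Position n} → Bounded (suc N) x → Bounded N (halve x)
Bounded-halve N {x} x<2^N i = *-cancelˡ-< 2 ⌊ x i /2⌋ (2 ^ N)
  (≤-<-trans (m≤n+m (2 * ⌊ x i /2⌋) (𝟙 (lsb (x i))))
             (subst (_< 2 ^ suc N) (sym (consBit-lsb-⌊/2⌋ (x i))) (x<2^N i)))

n<2^n : ∀ n → n < 2 ^ n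
n<2^n zero    = s≤s z≤n
n<2^n (suc n) = +-mono-≤ (m^n>0 2 n) (subst (suc n ≤_) (sym (+-identityʳ (2 ^ n))) (n<2^n n))

Bounded-S : ∀ {n} (x : Position n) → Bounded (S x) x
Bounded-S x i = ≤-<-trans (f≤S x i) (n<2^n (S x))

Balanced : ∀ {n} → ℕ → ℕ → Position n → Set
Balanced k zero    y = ∀ i → y i ≡ 0
Balanced k (suc N) y = suc k ∣ column y × Balanced k N (halve y)

Balanced-cong : ∀ {n} k N {x y : Position n} → x ≗ y → Balanced k N x → Balanced k N y
Balanced-cong k zero    x≗y x≡0 i = trans (sym (x≗y i)) (x≡0 i)
Balanced-cong k (suc N) x≗y (k+1∣column , halveB) =
  subst (suc k ∣_) (S-cong (λ i → cong (𝟙 ∘ lsb) (x≗y i))) k+1∣column ,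
  Balanced-cong k N (λ i → cong ⌊_/2⌋ (x≗y i)) halveB

∣∧≤⇒≡0 : ∀ {k d} → suc k ∣ d → d ≤ k → d ≡ 0
∣∧≤⇒≡0 {d = zero}  _     _   = refl
∣∧≤⇒≡0 {d = suc d} k+1∣d d≤k = ⊥-elim (>⇒∤ (s≤s d≤k) k+1∣d)

Balanced-#decreased≡0 : ∀ {n} k N {x y : Position n} → Balanced k N x → Balanced k N y →
                        y ≤ᵖ x → #decreased x y ≤ k → #decreased x y ≡ 0
Balanced-#decreased≡0 k zero {x} {y} x≡0 y≡0 _ _ = ≗⇒#decreased≡0 (λ i → trans (y≡0 i) (sym (x≡0 i)))
Balanced-#decreased≡0 k (suc N) {x} {y} (k+1∣colx , halvexB) (k+1∣coly , halveyB) y≤x #≤k =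
  ∣∧≤⇒≡0 (∣m+n∣m⇒∣n (subst (suc k ∣_) column-x k+1∣colx) k+1∣coly) #≤k
  where
  halves-equal : halve y ≗ halve x
  halves-equal = #decreased≡0⇒≗ (λ i → ⌊n/2⌋-mono (y≤x i))
    (Balanced-#decreased≡0 k N halvexB halveyB (λ i → ⌊n/2⌋-mono (y≤x i))
      (≤-trans (count-mono (λ i → <⇒<ᵇ ∘ ⌊/2⌋-<⇒< ∘ <ᵇ⇒< ⌊ y i /2⌋ ⌊ x i /2⌋)) #≤k))
  column-x : column x ≡ column y + #decreased x y
  column-x = trans (S-cong (λ i → lsb-step (y i) (x i) (y≤x i) (halves-equal i)))
                   (S-distrib-+ (𝟙 ∘ lsb ∘ y) (λ i → 𝟙 (y i <ᵇ x i)))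

Balanced-no-move : ∀ {n} k N {x y : Position n} → Balanced k N x → Balanced k N y → ¬ Move k x y
Balanced-no-move k N {x} {y} xB yB (y≤x , 1≤∣d∣ , ∣d∣≤k) = <⇒≱ (subst (1 ≤_) ∣d∣≡0 1≤∣d∣) z≤n
  where
  ∣d∣≡# : ∣ decreased x y ∣ ≡ #decreased x y
  ∣d∣≡# = ∣decreased∣≡#decreased x y
  ∣d∣≡0 : ∣ decreased x y ∣ ≡ 0
  ∣d∣≡0 = trans ∣d∣≡# (Balanced-#decreased≡0 k N xB yB y≤x (subst (_≤ k) ∣d∣≡# ∣d∣≤k))

-- The free piles were already decreased in a higher digit, so their digit here is arbitrary; ones
-- are the digits of x.  With r the remainder of the ones in the other piles, either r of these are
-- cleared, or, if that would change more than k piles, k + 1 - r free piles are set to 1.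
module ColumnBalancing {n} (k : ℕ) (free ones : Fin n → Bool) (#free≤k : count free ≤ k) where

  Balancing : Set
  Balancing = Σ (Fin n → Bool) λ b → b ⊆ᵇ (λ i → free i ∨ ones i) × suc k ∣ count b ×
                                      count (λ i → free i ∨ (ones i ∧ not (b i))) ≤ k

  settled : Fin n → Bool
  settled i = not (free i) ∧ ones i

  r q : ℕ
  r = count settled % suc k
  q = count settled / suc k

  count-settled : count settled ≡ r + q * suc k
  count-settled = m≡m%n+[m/n]*n (count settled) (suc k)

  clear-remainder : r ≤ k ∸ count free → Balancing
  clear-remainder r≤k∸f with subset-of-count settled r (m%n≤m (count settled) (suc k))
  ... | cleared , cleared⊆settled , #cleared≡r = b , b⊆ , divides q count-b , changed≤k
    where
    b : Fin n → Bool
    b i = settled i ∧ not (cleared i)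
    b⊆ : b ⊆ᵇ (λ i → free i ∨ ones i)
    b⊆ i = pointwise (free i) (ones i) (cleared i)
      where
      pointwise : ∀ f a c → T ((not f ∧ a) ∧ not c) → T (f ∨ a)
      pointwise false true false _ = tt
    count-b : count b ≡ q * suc k
    count-b = +-cancelˡ-≡ r (count b) (q * suc k) (begin
      r + count b             ≡⟨ +-comm r (count b) ⟩
      count b + r             ≡⟨ cong (count b +_) (sym #cleared≡r) ⟩
      count b + count cleared ≡⟨ count-∧-not cleared⊆settled ⟩
      count settled           ≡⟨ count-settled ⟩
      r + q * suc k           ∎)
      where open ≡-Reasoning
    changed≤k : count (λ i → free i ∨ (ones i ∧ not (b i))) ≤ k
    changed≤k = begin
      count (λ i → free i ∨ (ones i ∧ not (b i)))
        ≤⟨ S-mono-≤ (λ i → pointwise (free i) (ones i) (cleared i)) ⟩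
      S (λ i → 𝟙 (free i) + 𝟙 (cleared i))       ≡⟨ S-distrib-+ (𝟙 ∘ free) (𝟙 ∘ cleared) ⟩
      count free + count cleared                  ≡⟨ cong (count free +_) #cleared≡r ⟩
      count free + r                              ≤⟨ +-monoʳ-≤ (count free) r≤k∸f ⟩
      count free + (k ∸ count free)               ≡⟨ m+[n∸m]≡n #free≤k ⟩
      k                                           ∎
      where
      open ≤-Reasoning
      pointwise : ∀ f a c → 𝟙 (f ∨ (a ∧ not ((not f ∧ a) ∧ not c))) ≤ 𝟙 f + 𝟙 c
      pointwise true  a     c     = s≤s z≤n
      pointwise false false c     = z≤n
      pointwise false true  true  = ≤-refl
      pointwise false true  false = z≤n

  fill-remainder : k ∸ count free < r → Balancing
  fill-remainder k∸f<r with subset-of-count free (suc k ∸ r) #filled≤f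
    where
    #filled≤f : suc k ∸ r ≤ count free
    #filled≤f = m≤n+o⇒m∸n≤o (suc k) r
      (subst (_≤ r + count free) (cong suc (m∸n+n≡m #free≤k)) (+-monoˡ-≤ (count free) k∸f<r))
  ... | filled , filled⊆free , #filled≡k+1-r = b , b⊆ , divides (suc q) count-b , changed≤k
    where
    b : Fin n → Bool
    b i = settled i ∨ filled i
    b⊆ : b ⊆ᵇ (λ i → free i ∨ ones i)
    b⊆ i = pointwise (free i) (ones i) (filled i) (filled⊆free i)
      where
      pointwise : ∀ f a c → (T c → T f) → T ((not f ∧ a) ∨ c) → T (f ∨ a)
      pointwise true  a     c     _   _ = tt
      pointwise false true  c     _   _ = tt
      pointwise false false true  c⇒f _ = c⇒f tt
    disjoint : ∀ i → T (settled i) → ¬ T (filled i)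
    disjoint i settled-i filled-i with free i | filled⊆free i filled-i
    ... | true | _ = settled-i
    count-b : count b ≡ suc q * suc k
    count-b = begin
      count b                              ≡⟨ count-∨-disjoint disjoint ⟩
      count settled + count filled         ≡⟨ cong₂ _+_ count-settled #filled≡k+1-r ⟩
      (r + q * suc k) + (suc k ∸ r)        ≡⟨ +-assoc r (q * suc k) (suc k ∸ r) ⟩
      r + (q * suc k + (suc k ∸ r))        ≡⟨ cong (r +_) (+-comm (q * suc k) (suc k ∸ r)) ⟩
      r + ((suc k ∸ r) + q * suc k)        ≡⟨ sym (+-assoc r (suc k ∸ r) (q * suc k)) ⟩
      (r + (suc k ∸ r)) + q * suc k        ≡⟨ cong (_+ q * suc k) (m+[n∸m]≡n r≤k+1) ⟩
      suc k + q * suc k                    ∎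
      where
      open ≡-Reasoning
      r≤k+1 : r ≤ suc k
      r≤k+1 = <⇒≤ (m%n<n (count settled) (suc k))
    changed≤k : count (λ i → free i ∨ (ones i ∧ not (b i))) ≤ k
    changed≤k = ≤-trans (S-mono-≤ (λ i → pointwise (free i) (ones i) (filled i))) #free≤k
      where
      pointwise : ∀ f a c → 𝟙 (f ∨ (a ∧ not ((not f ∧ a) ∨ c))) ≤ 𝟙 f
      pointwise true  a     c = ≤-refl
      pointwise false true  c = z≤n
      pointwise false false c = z≤n

  balanceColumn : Balancing
  balanceColumn with r ≤? k ∸ count free
  ... | yes r≤k∸f = clear-remainder r≤k∸f
  ... | no  r≰k∸f = fill-remainder (≰⇒> r≰k∸f)

open ColumnBalancing using (balanceColumn)

Balanced-reachable : ∀ {n} k N (x : Position n) → Bounded N x →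
                     Σ (Position n) λ y → y ≤ᵖ x × #decreased x y ≤ k × Balanced k N y
Balanced-reachable k zero x x<1 =
  x , (λ i → ≤-refl) , subst (_≤ k) (sym (≗⇒#decreased≡0 {x = x} (λ i → refl))) z≤n ,
  (λ i → n<1⇒n≡0 (x<1 i))
Balanced-reachable {n} k (suc N) x x<2^N with Balanced-reachable k N (halve x) (Bounded-halve N x<2^N)
... | w , w≤halve , #w≤k , wB with balanceColumn k (λ i → w i <ᵇ ⌊ x i /2⌋) (lsb ∘ x) #w≤k
...   | b , b⊆ , k+1∣b , changed≤k = y , y≤x , #y≤k , column-y , halve-y
  where
  y : Position n
  y i = consBit (b i) (w i)
  y≤x : y ≤ᵖ x
  y≤x i = consBit-≤ (b i) (w i) (x i) (w≤halve i) (b⊆ i)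
  #y≤k : #decreased x y ≤ k
  #y≤k = ≤-trans
    (count-mono (λ i → consBit-decreased (b i) (w i) (x i) (w≤halve i) ∘ <ᵇ⇒< (y i) (x i)))
    changed≤k
  column-y : suc k ∣ column y
  column-y = subst (suc k ∣_) (S-cong (λ i → cong 𝟙 (sym (lsb-consBit (b i) (w i))))) k+1∣b
  halve-y : Balanced k N (halve y)
  halve-y = Balanced-cong k N (λ i → sym (⌊consBit/2⌋ (b i) (w i))) wB

Balanced-within-one-move : ∀ {n} k N (x : Position n) → Bounded N x →
                           Σ (Position n) λ y → Balanced k N y × (y ≗ x ⊎ Move k x y)
Balanced-within-one-move k N x x<2^N with Balanced-reachable k N x x<2^N
... | y , y≤x , #≤k , yB with #decreased x y ≟ 0
...   | yes #≡0 = y , yB , inj₁ (#decreased≡0⇒≗ y≤x #≡0)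
...   | no  #≢0 =
  y , yB , inj₂ (y≤x , subst (1 ≤_) (sym ∣d∣≡#) (n≢0⇒n>0 #≢0) , subst (_≤ k) (sym ∣d∣≡#) #≤k)
  where
  ∣d∣≡# : ∣ decreased x y ∣ ≡ #decreased x y
  ∣d∣≡# = ∣decreased∣≡#decreased x y

NPos⇒¬PPos : ∀ {n k} {x : Position n} → NPos k x → ¬ PPos k x
NPos⇒¬PPos (win y x→y yP) (lose replies) = NPos⇒¬PPos (replies y x→y) yP

Balanced⇒PPos : ∀ {n} k N {y : Position n} → Bounded N y → Balanced k N y → Acc _<_ (S y) → PPos k y
Balanced⇒PPos k N {y} y<2^N yB (acc smaller) = lose reply
  where
  reply : ∀ z → Move k y z → NPos k z
  reply z y→z with Balanced-within-one-move k N z (Bounded-≤ᵖ N (proj₁ y→z) y<2^N)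
  ... | u , uB , inj₁ u≗z = ⊥-elim (Balanced-no-move k N yB (Balanced-cong k N u≗z uB) y→z)
  ... | u , uB , inj₂ z→u = win u z→u (Balanced⇒PPos k N u<2^N uB (smaller S[u]<S[y]))
    where
    u<2^N : Bounded N u
    u<2^N = Bounded-≤ᵖ N (λ i → ≤-trans (proj₁ z→u i) (proj₁ y→z i)) y<2^N
    S[u]<S[y] : S u < S y
    S[u]<S[y] = <-trans (Move⇒S-< z→u) (Move⇒S-< y→z)

PPos⇒Balanced : ∀ {n} k N {y : Position n} → Bounded N y → PPos k y → Balanced k N y
PPos⇒Balanced k N {y} y<2^N (lose replies) with Balanced-within-one-move k N y y<2^N
... | z , zB , inj₁ z≗y = Balanced-cong k N z≗y zB
... | z , zB , inj₂ y→z = ⊥-elim (NPos⇒¬PPos (replies z y→z) zP)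
  where
  zP : PPos k z
  zP = Balanced⇒PPos k N (Bounded-≤ᵖ N (proj₁ y→z) y<2^N) zB (<-wellFounded (S z))

multiple-in-window : ∀ k s m → suc k ∣ m → s ≤ m → m ≤ s + k → m ≡ (s + k) / suc k * suc k
multiple-in-window k s m (divides q m≡q*[k+1]) s≤m m≤s+k = sym (begin
  (s + k) / suc k * suc k              ≡⟨ cong (λ t → t / suc k * suc k) (sym (m+[n∸m]≡n m≤s+k)) ⟩
  (m + t) / suc k * suc k              ≡⟨ cong (_* suc k) (+-distrib-/-∣ˡ t (divides q m≡q*[k+1])) ⟩
  (m / suc k + t / suc k) * suc k      ≡⟨ cong₂ (λ a b → (a + b) * suc k) m/[k+1]≡q (m<n⇒m/n≡0 t<k+1) ⟩
  (q + 0) * suc k                      ≡⟨ cong (_* suc k) (+-identityʳ q) ⟩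
  q * suc k                            ≡⟨ sym m≡q*[k+1] ⟩
  m                                    ∎)
  where
  open ≡-Reasoning
  t : ℕ
  t = s + k ∸ m
  t<k+1 : t < suc k
  t<k+1 = s≤s (≤-trans (∸-monoʳ-≤ (s + k) s≤m) (≤-reflexive (m+n∸m≡n s k)))
  m/[k+1]≡q : m / suc k ≡ q
  m/[k+1]≡q = trans (cong (_/ suc k) m≡q*[k+1]) (m*n/n≡m q (suc k))

lookup≡false⇒∉ : ∀ {n} (K : Subset n) i → lookup K i ≡ false → i ∉ K
lookup≡false⇒∉ K i K[i]≡false i∈K with trans (sym ([]=⇒lookup i∈K)) K[i]≡false
... | ()

fixedOnes : ∀ {n} → Subset n → Position n → ℕ
fixedOnes K x = count (λ i → not (lookup K i) ∧ lsb (x i))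

column-window : ∀ {n} (K : Subset n) (x y : Position n) → (∀ i → i ∉ K → y i ≡ x i) →
                fixedOnes K x ≤ column y × column y ≤ fixedOnes K x + ∣ K ∣
column-window K x y y≡x-off-K = S-mono-≤ (proj₁ ∘ bounds) , (begin
  column y                                                     ≤⟨ S-mono-≤ (proj₂ ∘ bounds) ⟩
  S (λ i → 𝟙 (not (lookup K i) ∧ lsb (x i)) + 𝟙 (lookup K i)) ≡⟨ S-distrib-+ _ (𝟙 ∘ lookup K) ⟩
  fixedOnes K x + count (lookup K)                             ≡⟨ cong (fixedOnes K x +_) (sym (∣p∣≡count K)) ⟩
  fixedOnes K x + ∣ K ∣                                         ∎)
  where
  open ≤-Reasoning
  pointwise : ∀ κ l l′ → (κ ≡ false → l′ ≡ l) → 𝟙 (not κ ∧ l) ≤ 𝟙 l′ × 𝟙 l′ ≤ 𝟙 (not κ ∧ l) + 𝟙 κ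
  pointwise true  l l′ _     = z≤n , 𝟙≤1 l′
  pointwise false l l′ l′≡l rewrite l′≡l refl = ≤-refl , m≤m+n (𝟙 l) 0
  bounds : ∀ i → 𝟙 (not (lookup K i) ∧ lsb (x i)) ≤ 𝟙 (lsb (y i)) ×
                 𝟙 (lsb (y i)) ≤ 𝟙 (not (lookup K i) ∧ lsb (x i)) + 𝟙 (lookup K i)
  bounds i = pointwise (lookup K i) (lsb (x i)) (lsb (y i))
                       (λ K[i]≡false → cong lsb (y≡x-off-K i (lookup≡false⇒∉ K i K[i]≡false)))

balancedSum : ∀ {n} → ℕ → Subset n → ℕ → Position n → ℕ
balancedSum k K zero    x = 0
balancedSum k K (suc N) x = (fixedOnes K x + k) / suc k * suc k + 2 * balancedSum k K N (halve x)

S-Balanced : ∀ {n} k N (K : Subset n) → ∣ K ∣ ≡ k → (x y : Position n) →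
             (∀ i → i ∉ K → y i ≡ x i) → Balanced k N y → S y ≡ balancedSum k K N x
S-Balanced k zero    K ∣K∣≡k x y _ y≡0 = S-0 y≡0
S-Balanced k (suc N) K ∣K∣≡k x y y≡x-off-K (k+1∣column , halveB) = begin
  S y                                          ≡⟨ S≡column+2*S[halve] y ⟩
  column y + 2 * S (halve y)                   ≡⟨ cong₂ (λ c h → c + 2 * h) column≡ halves ⟩
  balancedSum k K (suc N) x                    ∎
  where
  open ≡-Reasoning
  window : fixedOnes K x ≤ column y × column y ≤ fixedOnes K x + ∣ K ∣
  window = column-window K x y y≡x-off-K
  column≡ : column y ≡ (fixedOnes K x + k) / suc k * suc k
  column≡ = multiple-in-window k (fixedOnes K x) (column y) k+1∣column (proj₁ window)
              (subst (λ c → column y ≤ fixedOnes K x + c) ∣K∣≡k (proj₂ window))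
  halves : S (halve y) ≡ balancedSum k K N (halve x)
  halves = S-Balanced k N K ∣K∣≡k (halve x) (halve y)
                      (λ i i∉K → cong ⌊_/2⌋ (y≡x-off-K i i∉K)) halveB

mainTheorem2 : {n k : ℕ} → 0 < k → k ≤ n → (x : Position n) → NPos k x →
                 (K : Subset n) → ∣ K ∣ ≡ k →
                 Σ ℕ (λ D → (y : Position n) → Move k x y →
                   ((i : Fin n) → i ∉ K → y i ≡ x i) → PPos k y → S y ≡ D)
mainTheorem2 {k = k} _ _ x _ K ∣K∣≡k = balancedSum k K (S x) x , λ y x→y y≡x-off-K yP →
  S-Balanced k (S x) K ∣K∣≡k x y y≡x-off-K
    (PPos⇒Balanced k (S x) (Bounded-≤ᵖ (S x) (proj₁ x→y) (Bounded-S x)) yP)
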